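{- Let $k$ be a positive integer and $s>0$. There is a bijection between the set $\mathcal{FB}_0(s,k)$ and the set $\mathcal{B}^e(s,k)$.
   Context: A free ballot $(s,k)$-path of height $n$ is a lattice path from $(0,0)$ to $(s,n)$ using up steps $(k/2,1)$, down steps $(k/2,-1)$ and horizontal steps $(\ell,0)$ with $\ell$ an integer, $1\le\ell<k$ (it may go below the $x$-axis); $\mathcal{FB}_n(s,k)$ denotes the set of these. A ballot $(s,k)$-path of height $n$ is such a path that never lies below the $x$-axis. $\mathcal{B}^e(s,k)$ is the set of ballot $(s,k)$-paths of even height (the height being any even $n\ge0$). -}

module Defs where

open import Data.Nat using (ℕ; zero; suc; _+_; _*_; _≤_; _<_)
open import Data.Integer as ℤ using (ℤ; +_; -[1+_])
open import Data.List using (List; []; _∷_)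
open import Data.Product using (Σ; _×_)
open import Data.Unit using (⊤)
open import Relation.Binary.PropositionalEquality using (_≡_)

-- All x-coordinates are DOUBLED so that they are
-- natural numbers: an up/down step (k/2, ±1) has doubled width k, a horizontal
-- step (ℓ,0) with 1 ≤ ℓ < k has doubled width 2ℓ.
data Step (k : ℕ) : Set where
  up   : Step k
  down : Step k
  hor  : (ℓ : ℕ) → 1 ≤ ℓ → ℓ < k → Step k

dwidth : {k : ℕ} → Step k → ℕ
dwidth {k} up = k
dwidth {k} down = k
dwidth (hor ℓ _ _) = 2 * ℓ

dheight : {k : ℕ} → Step k → ℤ
dheight up = + 1
dheight down = -[1+ 0 ]
dheight (hor _ _ _) = + 0

pathDWidth : {k : ℕ} → List (Step k) → ℕ
pathDWidth [] = 0
pathDWidth (st ∷ p) = dwidth st + pathDWidth p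

pathHeight : {k : ℕ} → List (Step k) → ℤ
pathHeight [] = + 0
pathHeight (st ∷ p) = dheight st ℤ.+ pathHeight p

-- NeverBelow h p : starting at height h, every vertex of p has height ≥ 0
-- (steps are straight segments, so this is "never lies below the x-axis")
NeverBelow : {k : ℕ} → ℤ → List (Step k) → Set
NeverBelow h [] = ⊤
NeverBelow h (st ∷ p) = (+ 0 ℤ.≤ h ℤ.+ dheight st) × NeverBelow (h ℤ.+ dheight st) p

IsFreeBallot : (s k n : ℕ) → List (Step k) → Set
IsFreeBallot s k n p = (pathDWidth p ≡ 2 * s) × (pathHeight p ≡ + n)

IsBallot : (s k n : ℕ) → List (Step k) → Set
IsBallot s k n p = IsFreeBallot s k n p × NeverBelow (+ 0) p

FB : (n s k : ℕ) → Set
FB n s k = Σ (List (Step k)) (IsFreeBallot s k n)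

Be : (s k : ℕ) → Set
Be s k = Σ ℕ (λ m → Σ (List (Step k)) (IsBallot s k (2 * m)))

module Submission where

-- A free ballot path of height 0 is turned into a ballot path of even height
-- by scanning it from left to right and flipping every down step that takes
-- it to a new minimum (it becomes an up step).  The scan is a transducer
-- whose state d is the height of the input above its running minimum; the
-- output then ends at height 2·d_final and never goes below the axis.
--
-- The inverse comes from reversibility: read backwards (mirrored: reversed,
-- with up and down exchanged), each transducer step can be undone by the
-- same transducer.  Hence running the transducer on the mirrored output,
-- starting from the final state, recovers the mirrored input and the
-- initial state.  A ballot path b of height 2m is thus the image of the
-- mirror of (lift m (mirror b)), once one checks that this run ends in
-- state 0, i.e. that the resulting path has height 0.

open import Defs
open import Data.Nat using (ℕ; _≤_)
open import Function.Bundles using (_⤖_; mk↔ₛ′)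

open import Data.Nat as ℕ using (zero; suc; _*_; z≤n)
import Data.Nat.Properties as ℕP
open import Data.Integer as ℤ using (ℤ; +_; -[1+_]; +≤+)
import Data.Integer.Properties as ℤP
open import Data.Integer.Tactic.RingSolver using (solve-∀)
open import Data.List using (List; []; _∷_; _++_; [_]; map; reverse)
open import Data.List.Properties
  using (unfold-reverse; reverse-map; reverse-involutive; map-∘; map-cong; map-id)
open import Data.Product using (Σ; _×_; _,_; proj₁; proj₂)
open import Data.Unit using (tt)
open import Function using (_∘_)
open import Function.Properties.Inverse using (↔⇒⤖)
open import Relation.Nullary.Irrelevant using (Irrelevant)
open import Relation.Binary.PropositionalEquality
  using (_≡_; refl; sym; trans; cong; cong₂; subst; module ≡-Reasoning)
import Axiom.UniquenessOfIdentityProofs as UIP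
open ≡-Reasoning

mirror : {A : Set} → (A → A) → List A → List A
mirror f w = reverse (map f w)

mirror-∷ : {A : Set} (f : A → A) (a : A) (w : List A) →
           mirror f (a ∷ w) ≡ mirror f w ++ [ f a ]
mirror-∷ f a w = unfold-reverse (f a) (map f w)

mirror-involutive : {A : Set} {f : A → A} → (∀ a → f (f a) ≡ a) →
                    ∀ w → mirror f (mirror f w) ≡ w
mirror-involutive {f = f} f-inv w = begin
  reverse (map f (reverse (map f w)))  ≡⟨ cong reverse (reverse-map f (map f w)) ⟩
  reverse (reverse (map f (map f w)))  ≡⟨ reverse-involutive (map f (map f w)) ⟩
  map f (map f w)                      ≡⟨ map-∘ w ⟨
  map (f ∘ f) w                        ≡⟨ map-cong f-inv w ⟩
  map (λ a → a) w                      ≡⟨ map-id w ⟩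
  w                                    ∎

module Transducer {A S : Set} (δ : S → A → A × S) where

  output : S → List A → List A
  output q []      = []
  output q (a ∷ w) = proj₁ (δ q a) ∷ output (proj₂ (δ q a)) w

  final : S → List A → S
  final q []      = q
  final q (a ∷ w) = final (proj₂ (δ q a)) w

  output-++ : ∀ q u v → output q (u ++ v) ≡ output q u ++ output (final q u) v
  output-++ q []      v = refl
  output-++ q (a ∷ u) v = cong (proj₁ (δ q a) ∷_) (output-++ (proj₂ (δ q a)) u v)

  final-++ : ∀ q u v → final q (u ++ v) ≡ final (final q u) v
  final-++ q []      v = refl
  final-++ q (a ∷ u) v = final-++ (proj₂ (δ q a)) u v

  module Rewind (flip : A → A)
                (reversible : ∀ q a → δ (proj₂ (δ q a)) (flip (proj₁ (δ q a))) ≡ (flip a , q))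
                where

    final-rewind : ∀ q w → final (final q w) (mirror flip (output q w)) ≡ q
    final-rewind q []      = refl
    final-rewind q (a ∷ w) = begin
      final e (mirror flip (b ∷ output q′ w))             ≡⟨ cong (final e) (mirror-∷ flip b (output q′ w)) ⟩
      final e (mirror flip (output q′ w) ++ [ flip b ])   ≡⟨ final-++ e (mirror flip (output q′ w)) [ flip b ] ⟩
      final (final e (mirror flip (output q′ w))) [ flip b ]
                                                          ≡⟨ cong (λ r → final r [ flip b ]) (final-rewind q′ w) ⟩
      proj₂ (δ q′ (flip b))                               ≡⟨ cong proj₂ (reversible q a) ⟩
      q                                                   ∎
      where
      b = proj₁ (δ q a)
      q′ = proj₂ (δ q a)
      e = final q′ w

    output-rewind : ∀ q w → output (final q w) (mirror flip (output q w)) ≡ mirror flip w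
    output-rewind q []      = refl
    output-rewind q (a ∷ w) = begin
      output e (mirror flip (b ∷ output q′ w))            ≡⟨ cong (output e) (mirror-∷ flip b (output q′ w)) ⟩
      output e (mirror flip (output q′ w) ++ [ flip b ])  ≡⟨ output-++ e (mirror flip (output q′ w)) [ flip b ] ⟩
      output e (mirror flip (output q′ w))
        ++ output (final e (mirror flip (output q′ w))) [ flip b ]
                                                          ≡⟨ cong₂ (λ u r → u ++ output r [ flip b ])
                                                                   (output-rewind q′ w) (final-rewind q′ w) ⟩
      mirror flip w ++ [ proj₁ (δ q′ (flip b)) ]          ≡⟨ cong (λ c → mirror flip w ++ [ proj₁ c ]) (reversible q a) ⟩
      mirror flip w ++ [ flip a ]                         ≡⟨ mirror-∷ flip a w ⟨
      mirror flip (a ∷ w)                                 ∎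
      where
      b = proj₁ (δ q a)
      q′ = proj₂ (δ q a)
      e = final q′ w

twice : ℕ → ℤ
twice d = + (2 * d)

module Paths {k : ℕ} where

  flip : Step k → Step k
  flip up          = down
  flip down        = up
  flip (hor ℓ a b) = hor ℓ a b

  flip-involutive : ∀ (st : Step k) → flip (flip st) ≡ st
  flip-involutive up          = refl
  flip-involutive down        = refl
  flip-involutive (hor ℓ a b) = refl

  -- The path traversed backwards (the path rotated by a half turn).
  reversePath : List (Step k) → List (Step k)
  reversePath = mirror flip

  reversePath-involutive : ∀ (p : List (Step k)) → reversePath (reversePath p) ≡ p
  reversePath-involutive = mirror-involutive flip-involutive

  pathDWidth-++ : ∀ (p q : List (Step k)) → pathDWidth (p ++ q) ≡ pathDWidth p ℕ.+ pathDWidth q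
  pathDWidth-++ []       q = refl
  pathDWidth-++ (st ∷ p) q = trans (cong (dwidth st ℕ.+_) (pathDWidth-++ p q))
                                   (sym (ℕP.+-assoc (dwidth st) _ _))

  pathHeight-++ : ∀ (p q : List (Step k)) → pathHeight (p ++ q) ≡ pathHeight p ℤ.+ pathHeight q
  pathHeight-++ []       q = sym (ℤP.+-identityˡ _)
  pathHeight-++ (st ∷ p) q = trans (cong (λ z → dheight st ℤ.+ z) (pathHeight-++ p q))
                                   (sym (ℤP.+-assoc (dheight st) _ _))

  pathDWidth-reverse : ∀ (p : List (Step k)) → pathDWidth (reversePath p) ≡ pathDWidth p
  pathDWidth-reverse []       = refl
  pathDWidth-reverse (st ∷ p) = begin
    pathDWidth (reversePath (st ∷ p))                      ≡⟨ cong pathDWidth (mirror-∷ flip st p) ⟩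
    pathDWidth (reversePath p ++ [ flip st ])              ≡⟨ pathDWidth-++ (reversePath p) _ ⟩
    pathDWidth (reversePath p) ℕ.+ pathDWidth [ flip st ]  ≡⟨ cong₂ ℕ._+_ (pathDWidth-reverse p)
                                                                        (ℕP.+-identityʳ _) ⟩
    pathDWidth p ℕ.+ dwidth (flip st)                      ≡⟨ ℕP.+-comm (pathDWidth p) _ ⟩
    dwidth (flip st) ℕ.+ pathDWidth p                      ≡⟨ cong (ℕ._+ pathDWidth p) (flip-dwidth st) ⟩
    pathDWidth (st ∷ p)                                    ∎
    where
    flip-dwidth : ∀ (st : Step k) → dwidth (flip st) ≡ dwidth st
    flip-dwidth up          = refl
    flip-dwidth down        = refl
    flip-dwidth (hor ℓ a b) = refl

  flip-dheight : ∀ (st : Step k) → dheight (flip st) ≡ ℤ.- dheight st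
  flip-dheight up          = refl
  flip-dheight down        = refl
  flip-dheight (hor ℓ a b) = refl

  pathHeight-reverse : ∀ (p : List (Step k)) → pathHeight (reversePath p) ≡ ℤ.- pathHeight p
  pathHeight-reverse []       = refl
  pathHeight-reverse (st ∷ p) = begin
    pathHeight (reversePath (st ∷ p))                       ≡⟨ cong pathHeight (mirror-∷ flip st p) ⟩
    pathHeight (reversePath p ++ [ flip st ])               ≡⟨ pathHeight-++ (reversePath p) _ ⟩
    pathHeight (reversePath p) ℤ.+ pathHeight [ flip st ]   ≡⟨ cong₂ ℤ._+_ (pathHeight-reverse p)
                                                                         (ℤP.+-identityʳ _) ⟩
    ℤ.- pathHeight p ℤ.+ dheight (flip st)                  ≡⟨ cong (λ z → ℤ.- pathHeight p ℤ.+ z) (flip-dheight st) ⟩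
    ℤ.- pathHeight p ℤ.+ ℤ.- dheight st                     ≡⟨ ℤP.+-comm (ℤ.- pathHeight p) _ ⟩
    ℤ.- dheight st ℤ.+ ℤ.- pathHeight p                     ≡⟨ ℤP.neg-distrib-+ (dheight st) _ ⟨
    ℤ.- pathHeight (st ∷ p)                                 ∎

  NeverBelow-++ : ∀ h (p q : List (Step k)) → NeverBelow h p → NeverBelow (h ℤ.+ pathHeight p) q →
                  NeverBelow h (p ++ q)
  NeverBelow-++ h []       q _ above-q = subst (λ z → NeverBelow z q) (ℤP.+-identityʳ h) above-q
  NeverBelow-++ h (st ∷ p) q (here , above-p) above-q =
    here , NeverBelow-++ (h ℤ.+ dheight st) p q above-p
             (subst (λ z → NeverBelow z q) (sym (ℤP.+-assoc h (dheight st) (pathHeight p))) above-q)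

  NeverBelow-reverse : ∀ h (p : List (Step k)) → + 0 ℤ.≤ h → NeverBelow h p →
                       NeverBelow (h ℤ.+ pathHeight p) (reversePath p)
  NeverBelow-reverse h []       _   _              = tt
  NeverBelow-reverse h (st ∷ p) 0≤h (here , above) =
    subst (NeverBelow (h ℤ.+ pathHeight (st ∷ p))) (sym (mirror-∷ flip st p))
      (NeverBelow-++ end (reversePath p) [ flip st ]
        (subst (λ z → NeverBelow z (reversePath p)) (ℤP.+-assoc h (dheight st) (pathHeight p))
          (NeverBelow-reverse (h ℤ.+ dheight st) p here above))
        (subst (λ z → + 0 ℤ.≤ z) (sym back-to-start) 0≤h , tt))
    where
    end = h ℤ.+ pathHeight (st ∷ p)
    back-to-start : end ℤ.+ pathHeight (reversePath p) ℤ.+ dheight (flip st) ≡ h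
    back-to-start = begin
      end ℤ.+ pathHeight (reversePath p) ℤ.+ dheight (flip st)
        ≡⟨ cong₂ (λ u v → end ℤ.+ u ℤ.+ v) (pathHeight-reverse p) (flip-dheight st) ⟩
      h ℤ.+ (dheight st ℤ.+ pathHeight p) ℤ.+ ℤ.- pathHeight p ℤ.+ ℤ.- dheight st
        ≡⟨ cancel h (dheight st) (pathHeight p) ⟩
      h ∎
      where
      cancel : ∀ h a b → h ℤ.+ (a ℤ.+ b) ℤ.+ ℤ.- b ℤ.+ ℤ.- a ≡ h
      cancel = solve-∀

  NeverBelow-irrelevant : ∀ h (p : List (Step k)) → Irrelevant (NeverBelow h p)
  NeverBelow-irrelevant h []       tt       tt       = refl
  NeverBelow-irrelevant h (st ∷ p) (a , u) (b , v) =
    cong₂ _,_ (ℤP.≤-irrelevant a b) (NeverBelow-irrelevant _ p u v)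

  -- One step of the flipping scan.  The state d is the height of the input
  -- above its running minimum; a down step taken at d = 0 reaches a new
  -- minimum and is emitted as an up step.
  liftStep : ℕ → Step k → Step k × ℕ
  liftStep d       up          = up , suc d
  liftStep zero    down        = up , zero
  liftStep (suc d) down        = down , d
  liftStep d       (hor ℓ a b) = hor ℓ a b , d

  liftStep-reversible : ∀ d st →
    liftStep (proj₂ (liftStep d st)) (flip (proj₁ (liftStep d st))) ≡ (flip st , d)
  liftStep-reversible d       up          = refl
  liftStep-reversible zero    down        = refl
  liftStep-reversible (suc d) down        = refl
  liftStep-reversible d       (hor ℓ a b) = refl

  open Transducer liftStep public
    using () renaming (output to lift; final to excess)
  open Transducer.Rewind liftStep flip liftStep-reversible public
    using () renaming (output-rewind to lift-rewind; final-rewind to excess-rewind)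

  liftStep-dwidth : ∀ d (st : Step k) → dwidth (proj₁ (liftStep d st)) ≡ dwidth st
  liftStep-dwidth d       up          = refl
  liftStep-dwidth zero    down        = refl
  liftStep-dwidth (suc d) down        = refl
  liftStep-dwidth d       (hor ℓ a b) = refl

  liftStep-dheight : ∀ d (st : Step k) →
    dheight (proj₁ (liftStep d st)) ℤ.+ dheight st ℤ.+ twice d ≡ twice (proj₂ (liftStep d st))
  liftStep-dheight d       up          = cong +_ (sym (ℕP.*-suc 2 d))
  liftStep-dheight zero    down        = refl
  liftStep-dheight (suc d) down        = cong (λ n → -[1+ 1 ] ℤ.+ + n) (ℕP.*-suc 2 d)
  liftStep-dheight d       (hor ℓ a b) = refl

  private
    up-bound : ∀ {d L} → + d ℤ.≤ L → + suc d ℤ.≤ L ℤ.+ + 1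
    up-bound {L = L} d≤L = subst (λ z → _ ℤ.≤ z) (ℤP.+-comm (+ 1) L) (ℤP.+-monoʳ-≤ (+ 1) d≤L)

    down-bound : ∀ {d L} → + suc d ℤ.≤ L → + d ℤ.≤ L ℤ.+ -[1+ 0 ]
    down-bound = ℤP.+-monoˡ-≤ -[1+ 0 ]

    level-bound : ∀ {d L} → + d ℤ.≤ L → + d ℤ.≤ L ℤ.+ + 0
    level-bound {L = L} d≤L = subst (λ z → _ ℤ.≤ z) (sym (ℤP.+-identityʳ L)) d≤L

    nonneg : ∀ {d} → + 0 ℤ.≤ + d
    nonneg = +≤+ z≤n

  liftStep-output-bound : ∀ {L} d (st : Step k) → + d ℤ.≤ L →
    + proj₂ (liftStep d st) ℤ.≤ L ℤ.+ dheight (proj₁ (liftStep d st))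
  liftStep-output-bound d       up          d≤L = up-bound d≤L
  liftStep-output-bound zero    down        d≤L = ℤP.≤-trans nonneg (up-bound d≤L)
  liftStep-output-bound (suc d) down        d≤L = down-bound d≤L
  liftStep-output-bound d       (hor ℓ a b) d≤L = level-bound d≤L

  liftStep-input-bound : ∀ {h} d (st : Step k) → + d ℤ.≤ h → + 0 ℤ.≤ h ℤ.+ dheight st →
    + proj₂ (liftStep d st) ℤ.≤ h ℤ.+ dheight st
  liftStep-input-bound d       up          d≤h _   = up-bound d≤h
  liftStep-input-bound zero    down        _   0≤h = 0≤h
  liftStep-input-bound (suc d) down        d≤h _   = down-bound d≤h
  liftStep-input-bound d       (hor ℓ a b) d≤h _   = level-bound d≤h

  lift-dwidth : ∀ d (p : List (Step k)) → pathDWidth (lift d p) ≡ pathDWidth p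
  lift-dwidth d []       = refl
  lift-dwidth d (st ∷ p) = cong₂ ℕ._+_ (liftStep-dwidth d st) (lift-dwidth (proj₂ (liftStep d st)) p)

  lift-height : ∀ d (p : List (Step k)) →
    pathHeight (lift d p) ℤ.+ pathHeight p ℤ.+ twice d ≡ twice (excess d p)
  lift-height d []       = refl
  lift-height d (st ∷ p) = begin
    (dheight t ℤ.+ pathHeight (lift d′ p)) ℤ.+ (dheight st ℤ.+ pathHeight p) ℤ.+ twice d
      ≡⟨ regroup (dheight t) (pathHeight (lift d′ p)) (dheight st) (pathHeight p) (twice d) ⟩
    pathHeight (lift d′ p) ℤ.+ pathHeight p ℤ.+ (dheight t ℤ.+ dheight st ℤ.+ twice d)
      ≡⟨ cong (λ z → pathHeight (lift d′ p) ℤ.+ pathHeight p ℤ.+ z) (liftStep-dheight d st) ⟩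
    pathHeight (lift d′ p) ℤ.+ pathHeight p ℤ.+ twice d′
      ≡⟨ lift-height d′ p ⟩
    twice (excess d′ p) ∎
    where
    t = proj₁ (liftStep d st)
    d′ = proj₂ (liftStep d st)
    regroup : ∀ a b c e f → (a ℤ.+ b) ℤ.+ (c ℤ.+ e) ℤ.+ f ≡ b ℤ.+ e ℤ.+ (a ℤ.+ c ℤ.+ f)
    regroup = solve-∀

  lift-neverBelow : ∀ d L (p : List (Step k)) → + d ℤ.≤ L → NeverBelow L (lift d p)
  lift-neverBelow d L []       _   = tt
  lift-neverBelow d L (st ∷ p) d≤L =
    ℤP.≤-trans nonneg bound , lift-neverBelow (proj₂ (liftStep d st)) _ p bound
    where bound = liftStep-output-bound d st d≤L

  excess-bound : ∀ d h (p : List (Step k)) → + d ℤ.≤ h → NeverBelow h p →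
                 + excess d p ℤ.≤ h ℤ.+ pathHeight p
  excess-bound d h []       d≤h _              = level-bound d≤h
  excess-bound d h (st ∷ p) d≤h (here , above) =
    ℤP.≤-trans (excess-bound (proj₂ (liftStep d st)) _ p (liftStep-input-bound d st d≤h here) above)
               (ℤP.≤-reflexive (ℤP.+-assoc h (dheight st) (pathHeight p)))

  -- Scanning the reversal of a ballot path of height 2m from state m ends
  -- in state 0: the state is bounded by the height, which returns to 0.
  excess-of-ballot : ∀ m (b : List (Step k)) → pathHeight b ≡ twice m → NeverBelow (+ 0) b →
                     excess m (reversePath b) ≡ 0
  excess-of-ballot m b height above =
    ℕP.n≤0⇒n≡0 (ℤP.drop‿+≤+ (subst (λ z → + excess m (reversePath b) ℤ.≤ z) returns bound))
    where
    m≤start : + m ℤ.≤ + 0 ℤ.+ pathHeight b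
    m≤start = subst (λ z → + m ℤ.≤ + 0 ℤ.+ z) (sym height) (+≤+ (ℕP.m≤m+n m (m ℕ.+ 0)))
    bound : + excess m (reversePath b) ℤ.≤ + 0 ℤ.+ pathHeight b ℤ.+ pathHeight (reversePath b)
    bound = excess-bound m _ (reversePath b) m≤start (NeverBelow-reverse (+ 0) b nonneg above)
    returns : + 0 ℤ.+ pathHeight b ℤ.+ pathHeight (reversePath b) ≡ + 0
    returns = trans (cong (λ z → + 0 ℤ.+ pathHeight b ℤ.+ z) (pathHeight-reverse b))
                    (cancel (pathHeight b))
      where
      cancel : ∀ a → + 0 ℤ.+ a ℤ.+ ℤ.- a ≡ + 0
      cancel = solve-∀

Σ-≡-irrelevant : {A : Set} {P : A → Set} → (∀ a → Irrelevant (P a)) →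
                 {x y : Σ A P} → proj₁ x ≡ proj₁ y → x ≡ y
Σ-≡-irrelevant irr {a , u} {.a , v} refl = cong (a ,_) (irr a u v)

IsFreeBallot-irrelevant : ∀ s k n (p : List (Step k)) → Irrelevant (IsFreeBallot s k n p)
IsFreeBallot-irrelevant s k n p (w , h) (w′ , h′) =
  cong₂ _,_ (ℕP.≡-irrelevant w w′) (UIP.Decidable⇒UIP.≡-irrelevant ℤP._≟_ h h′)

IsBallot-irrelevant : ∀ s k n (p : List (Step k)) → Irrelevant (IsBallot s k n p)
IsBallot-irrelevant s k n p (f , a) (f′ , a′) =
  cong₂ _,_ (IsFreeBallot-irrelevant s k n p f f′) (Paths.NeverBelow-irrelevant (+ 0) p a a′)

module Bijection (s k : ℕ) where
  open Paths {k}

  toBallot : FB 0 s k → Be s k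
  toBallot (p , width , height) =
    excess 0 p , lift 0 p , (trans (lift-dwidth 0 p) width , ending) , lift-neverBelow 0 (+ 0) p (+≤+ z≤n)
    where
    ending : pathHeight (lift 0 p) ≡ twice (excess 0 p)
    ending = begin
      pathHeight (lift 0 p)                           ≡⟨ sym (add-zeros (pathHeight (lift 0 p))) ⟩
      pathHeight (lift 0 p) ℤ.+ + 0 ℤ.+ twice 0      ≡⟨ cong (λ z → pathHeight (lift 0 p) ℤ.+ z ℤ.+ twice 0) (sym height) ⟩
      pathHeight (lift 0 p) ℤ.+ pathHeight p ℤ.+ twice 0  ≡⟨ lift-height 0 p ⟩
      twice (excess 0 p)                              ∎
      where
      add-zeros : ∀ a → a ℤ.+ + 0 ℤ.+ + 0 ≡ a
      add-zeros = solve-∀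

  fromBallot : Be s k → FB 0 s k
  fromBallot (m , b , (width , height) , above) = reversePath q , width′ , height′
    where
    q = lift m (reversePath b)
    width′ : pathDWidth (reversePath q) ≡ 2 * s
    width′ = begin
      pathDWidth (reversePath q)   ≡⟨ pathDWidth-reverse q ⟩
      pathDWidth q                 ≡⟨ lift-dwidth m (reversePath b) ⟩
      pathDWidth (reversePath b)   ≡⟨ pathDWidth-reverse b ⟩
      pathDWidth b                 ≡⟨ width ⟩
      2 * s                        ∎
    q-flat : pathHeight q ≡ + 0
    q-flat = begin
      pathHeight q                                        ≡⟨ sym (cancel (pathHeight q) (twice m)) ⟩
      pathHeight q ℤ.+ ℤ.- twice m ℤ.+ twice m            ≡⟨ cong (λ z → pathHeight q ℤ.+ ℤ.- z ℤ.+ twice m) (sym height) ⟩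
      pathHeight q ℤ.+ ℤ.- pathHeight b ℤ.+ twice m       ≡⟨ cong (λ z → pathHeight q ℤ.+ z ℤ.+ twice m) (sym (pathHeight-reverse b)) ⟩
      pathHeight q ℤ.+ pathHeight (reversePath b) ℤ.+ twice m  ≡⟨ lift-height m (reversePath b) ⟩
      twice (excess m (reversePath b))                    ≡⟨ cong twice (excess-of-ballot m b height above) ⟩
      + 0                                                 ∎
      where
      cancel : ∀ a c → a ℤ.+ ℤ.- c ℤ.+ c ≡ a
      cancel = solve-∀
    height′ : pathHeight (reversePath q) ≡ + 0
    height′ = trans (pathHeight-reverse q) (cong ℤ.-_ q-flat)

  Be-≡ : {x y : Be s k} → proj₁ x ≡ proj₁ y → proj₁ (proj₂ x) ≡ proj₁ (proj₂ y) → x ≡ y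
  Be-≡ {m , _} {.m , _} refl same-path =
    cong (m ,_) (Σ-≡-irrelevant (IsBallot-irrelevant s k (2 * m)) same-path)

  fromBallot∘toBallot : ∀ x → fromBallot (toBallot x) ≡ x
  fromBallot∘toBallot (p , _) = Σ-≡-irrelevant (IsFreeBallot-irrelevant s k 0)
    (trans (cong reversePath (lift-rewind 0 p)) (reversePath-involutive p))

  toBallot∘fromBallot : ∀ y → toBallot (fromBallot y) ≡ y
  toBallot∘fromBallot (m , b , (width , height) , above) = Be-≡ excess-returns lift-returns
    where
    r = reversePath (lift m (reversePath b))
    -- the rescan ends in state 0, so rescanning r from 0 rewinds it
    ends-at-0 : excess m (reversePath b) ≡ 0
    ends-at-0 = excess-of-ballot m b height above
    excess-returns : excess 0 r ≡ m
    excess-returns = subst (λ z → excess z r ≡ m) ends-at-0 (excess-rewind m (reversePath b))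
    lift-returns : lift 0 r ≡ b
    lift-returns = subst (λ z → lift z r ≡ b) ends-at-0
      (trans (lift-rewind m (reversePath b)) (reversePath-involutive b))

theorem2p14 : (s k : ℕ) → 1 ≤ k → 1 ≤ s → FB 0 s k ⤖ Be s k
theorem2p14 s k _ _ = ↔⇒⤖ (mk↔ₛ′ toBallot fromBallot toBallot∘fromBallot fromBallot∘toBallot)
  where open Bijection s k
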